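{- Let $A_n$ be a path-independent stream automaton over $[1,n]$ with kernel $M$ and initial configuration $o$. The mapping $x+M\mapsto x+o$ is a well-defined bijection between $\mathbb{Z}^n/M$ and the set of reachable configurations $\{x+o : x\in\mathbb{Z}^n\}$. Moreover, $A_n$ gives the same output on all streams whose frequency vectors lie in the same coset $x+M$, $x\in\mathbb{Z}^n$.
   Context: A stream over $[1,n]$ is a finite sequence of records $\pm e_i$ ($e_i$ standard basis vectors of $\mathbb{Z}^n$); $\mathrm{freq}\,\sigma$ is the sum of its records. A stream automaton is a deterministic Turing machine with finite control, a work tape and a one-way input tape holding the stream; configurations evolve by $a\oplus v$ on record $v$, extended left-associatively to streams; the output is determined by the configuration reached at the end of the stream. $A_n$ is path independent if for every configuration $s$ and stream $\sigma$, $s\oplus\sigma$ depends only on $s$ and $\mathrm{freq}\,\sigma$; then $x+a := a\oplus\sigma$ for any $\sigma$ with $\mathrm{freq}\,\sigma = x$. The kernel is $M=\{x\in\mathbb{Z}^n : x+o=0+o\}$, a sub-module of $\mathbb{Z}^n$. -}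

module Defs where

open import Data.Nat using (ℕ; zero; suc)
open import Data.Integer using (ℤ; +_; -[1+_]; _-_) renaming (_+_ to _+ℤ_)
open import Data.Fin using (Fin)
open import Data.Bool using (Bool; true; false)
open import Data.List using (List; []; _∷_; _++_; foldl; replicate; concatMap; allFin)
open import Data.Product using (Σ; _×_; _,_)
open import Relation.Binary.PropositionalEquality using (_≡_)
open import Relation.Nullary using (yes; no)
open import Data.Fin using (_≟_)

-- Vectors of ℤ^n as functions; equality of such vectors is pointwise (_≗_).
Vecℤ : ℕ → Set
Vecℤ n = Fin n → ℤ

0ᵥ : ∀ {n} → Vecℤ n
0ᵥ _ = + 0

_-ᵥ_ : ∀ {n} → Vecℤ n → Vecℤ n → Vecℤ n
(x -ᵥ y) i = x i - y i

-- A record ± e_i : (i , true) is + e_i, (i , false) is - e_i.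
Record : ℕ → Set
Record n = Fin n × Bool

Stream : ℕ → Set
Stream n = List (Record n)

recVec : ∀ {n} → Record n → Vecℤ n
recVec (i , s) j with i ≟ j
... | no _ = + 0
recVec (i , true)  j | yes _ = + 1
recVec (i , false) j | yes _ = -[1+ 0 ]

freq : ∀ {n} → Stream n → Vecℤ n
freq [] j = + 0
freq (r ∷ σ) j = recVec r j +ℤ freq σ j

-- A (deterministic) stream automaton, abstracted to its configuration
-- dynamics: configurations, one-record transition a ⊕ v, initial
-- configuration o, and output as a function of the final configuration.
record StreamAutomaton (n : ℕ) : Set₁ where
  field
    Config : Set
    Output : Set
    _⊕_    : Config → Record n → Config
    init   : Config
    out    : Config → Output

  _⊕*_ : Config → Stream n → Config
  a ⊕* σ = foldl _⊕_ a σ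

  run : Stream n → Output
  run σ = out (init ⊕* σ)

module _ {n : ℕ} (A : StreamAutomaton n) where
  open StreamAutomaton A

  PathIndependent : Set
  PathIndependent = ∀ (s : Config) (σ τ : Stream n) →
    (∀ j → freq σ j ≡ freq τ j) → s ⊕* σ ≡ s ⊕* τ

coordStream : ∀ {n} → Fin n → ℤ → Stream n
coordStream i (+ k)     = replicate k (i , true)
coordStream i -[1+ k ]  = replicate (suc k) (i , false)

streamOf : ∀ {n} → Vecℤ n → Stream n
streamOf {n} x = concatMap (λ i → coordStream i (x i)) (allFin n)

module _ {n : ℕ} (A : StreamAutomaton n) where
  open StreamAutomaton A

  -- x + a := a ⊕ σ for a stream σ with freq σ = x (here the canonical one;
  -- under path independence any such σ gives the same result)
  _+ᶜ_ : Vecℤ n → Config → Config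
  x +ᶜ a = a ⊕* streamOf x

  InKernel : Vecℤ n → Set
  InKernel x = x +ᶜ init ≡ 0ᵥ +ᶜ init

  Reachable : Config → Set
  Reachable c = Σ (Vecℤ n) λ x → c ≡ x +ᶜ init

{-# OPTIONS --safe #-}
-- Path independence turns x + a into a right action of the group ℤⁿ on
-- configurations: x + a depends only on the frequency vector, and
-- concatenating canonical streams adds frequency vectors. For any right
-- action of a group, o·g = o·h iff o·(g h⁻¹) = o·ε, which is exactly the
-- bijection ℤⁿ/M ≅ {x + o}. The output on σ is read off o·(freq σ), so it
-- only depends on the coset freq σ + M.
module Submission where

open import Defs
open import Data.Nat using (ℕ; zero; suc)
open import Data.Product using (Σ; _×_; _,_)
open import Relation.Binary.PropositionalEquality
  using (_≡_; _≢_; _≗_; refl; sym; trans; cong; cong₂; module ≡-Reasoning)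
open import Data.Integer using (ℤ; +_; -[1+_]) renaming (_+_ to _+ℤ_)
import Data.Integer.Properties as ℤP
open import Data.Fin using (Fin; _≟_) renaming (zero to fz; suc to fs)
open import Data.Bool using (Bool; true; false)
open import Data.List using ([]; _∷_; _++_; concat; tabulate)
import Data.List.Properties as Listₚ
open import Relation.Nullary using (yes; no)
open import Data.Empty using (⊥-elim)
open import Function using (id; _∘_)
open import Level using (0ℓ)
open import Algebra.Bundles using (Group; AbelianGroup)
import Algebra.Construct.Pointwise as Pointwise
import Algebra.Properties.Group as GroupProperties
open import Algebra.Properties.Monoid.Sum ℤP.+-0-monoid using (sum; sum-cong-≗; sum-replicate-zero)

-- k ·e i is k times the i-th standard basis vector, defined by recursion
-- rather than via _≟_ so that it computes on constructors.
_·e_ : ∀ {N} → ℤ → Fin N → Vecℤ N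
(k ·e fz)   fz     = k
(k ·e fz)   (fs _) = + 0
(k ·e fs _) fz     = + 0
(k ·e fs i) (fs j) = (k ·e i) j

·e-diagonal : ∀ {N} (i : Fin N) k → (k ·e i) i ≡ k
·e-diagonal fz     k = refl
·e-diagonal (fs i) k = ·e-diagonal i k

·e-offDiagonal : ∀ {N} {i j : Fin N} k → i ≢ j → (k ·e i) j ≡ + 0
·e-offDiagonal {i = fz}   {fz}   k i≢j = ⊥-elim (i≢j refl)
·e-offDiagonal {i = fz}   {fs j} k i≢j = refl
·e-offDiagonal {i = fs i} {fz}   k i≢j = refl
·e-offDiagonal {i = fs i} {fs j} k i≢j = ·e-offDiagonal k (i≢j ∘ cong fs)

0·e : ∀ {N} (i j : Fin N) → ((+ 0) ·e i) j ≡ + 0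
0·e fz     fz     = refl
0·e fz     (fs j) = refl
0·e (fs i) fz     = refl
0·e (fs i) (fs j) = 0·e i j

·e-distrib-+ : ∀ {N} (i j : Fin N) a b → (a ·e i) j +ℤ (b ·e i) j ≡ ((a +ℤ b) ·e i) j
·e-distrib-+ fz     fz     a b = refl
·e-distrib-+ fz     (fs j) a b = refl
·e-distrib-+ (fs i) fz     a b = refl
·e-distrib-+ (fs i) (fs j) a b = ·e-distrib-+ i j a b

sign : Bool → ℤ
sign true  = + 1
sign false = -[1+ 0 ]

recVec≡sign·e : ∀ {N} (i : Fin N) s j → recVec (i , s) j ≡ (sign s ·e i) j
recVec≡sign·e i s j with i ≟ j
recVec≡sign·e i true  .i | yes refl = sym (·e-diagonal i (+ 1))
recVec≡sign·e i false .i | yes refl = sym (·e-diagonal i -[1+ 0 ])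
recVec≡sign·e i s     j  | no i≢j   = sym (·e-offDiagonal (sign s) i≢j)

sum-·e : ∀ {N} (x : Vecℤ N) j → sum (λ i → (x i ·e i) j) ≡ x j
sum-·e {suc N} x fz     = trans (cong (x fz +ℤ_) (sum-replicate-zero N)) (ℤP.+-identityʳ (x fz))
sum-·e {suc N} x (fs j) = trans (ℤP.+-identityˡ _) (sum-·e (x ∘ fs) j)

freq-++ : ∀ {n} (σ τ : Stream n) j → freq (σ ++ τ) j ≡ freq σ j +ℤ freq τ j
freq-++ []      τ j = sym (ℤP.+-identityˡ (freq τ j))
freq-++ (r ∷ σ) τ j = trans (cong (recVec r j +ℤ_) (freq-++ σ τ j)) (sym (ℤP.+-assoc (recVec r j) _ _))

freq-concat-tabulate : ∀ {n N} (h : Fin N → Stream n) j →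
  freq (concat (tabulate h)) j ≡ sum (λ i → freq (h i) j)
freq-concat-tabulate {N = zero}  h j = refl
freq-concat-tabulate {N = suc N} h j =
  trans (freq-++ (h fz) (concat (tabulate (h ∘ fs))) j)
        (cong (freq (h fz) j +ℤ_) (freq-concat-tabulate (h ∘ fs) j))

freq-coordStream : ∀ {n} (i : Fin n) k j → freq (coordStream i k) j ≡ (k ·e i) j
freq-coordStream i (+ zero)      j = sym (0·e i j)
freq-coordStream i (+ suc k)     j =
  trans (cong₂ _+ℤ_ (recVec≡sign·e i true j) (freq-coordStream i (+ k) j))
        (·e-distrib-+ i j (+ 1) (+ k))
freq-coordStream i -[1+ zero ]  j =
  trans (ℤP.+-identityʳ (recVec (i , false) j)) (recVec≡sign·e i false j)
freq-coordStream i -[1+ suc k ] j =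
  trans (cong₂ _+ℤ_ (recVec≡sign·e i false j) (freq-coordStream i -[1+ k ] j))
        (·e-distrib-+ i j -[1+ 0 ] -[1+ k ])

freq-streamOf : ∀ {n} (x : Vecℤ n) → freq (streamOf x) ≗ x
freq-streamOf {n} x j = begin
  freq (streamOf x) j
    ≡⟨ cong (λ σs → freq (concat σs) j) (Listₚ.map-tabulate id coordStreamOf) ⟩
  freq (concat (tabulate coordStreamOf)) j
    ≡⟨ freq-concat-tabulate coordStreamOf j ⟩
  sum (λ i → freq (coordStreamOf i) j)
    ≡⟨ sum-cong-≗ (λ i → freq-coordStream i (x i) j) ⟩
  sum (λ i → (x i ·e i) j)
    ≡⟨ sum-·e x j ⟩
  x j ∎
  where
  open ≡-Reasoning
  coordStreamOf : Fin n → Stream n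
  coordStreamOf i = coordStream i (x i)

module RightActionKernel {c ℓ a} (G : Group c ℓ) {X : Set a} (o : X)
  (_▹_ : X → Group.Carrier G → X)
  (▹-cong : ∀ s {g h} → Group._≈_ G g h → s ▹ g ≡ s ▹ h)
  (▹-∙ : ∀ s g h → s ▹ Group._∙_ G g h ≡ (s ▹ g) ▹ h)
  where
  open Group G using (Carrier; _∙_; _⁻¹; ε; identityˡ; inverseʳ)
  open GroupProperties G using (//-rightDividesˡ)
  open ≡-Reasoning

  -- Taken relative to o ▹ ε rather than o, so no identity law is needed.
  Kernel : Carrier → Set a
  Kernel g = o ▹ g ≡ o ▹ ε

  ∙⁻¹∈Kernel⇒▹-≡ : ∀ g h → Kernel (g ∙ h ⁻¹) → o ▹ g ≡ o ▹ h
  ∙⁻¹∈Kernel⇒▹-≡ g h gh⁻¹∈K = begin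
    o ▹ g                ≡⟨ ▹-cong o (//-rightDividesˡ h g) ⟨
    o ▹ (g ∙ h ⁻¹ ∙ h)   ≡⟨ ▹-∙ o (g ∙ h ⁻¹) h ⟩
    (o ▹ (g ∙ h ⁻¹)) ▹ h ≡⟨ cong (_▹ h) gh⁻¹∈K ⟩
    (o ▹ ε) ▹ h          ≡⟨ ▹-∙ o ε h ⟨
    o ▹ (ε ∙ h)          ≡⟨ ▹-cong o (identityˡ h) ⟩
    o ▹ h                ∎

  ▹-≡⇒∙⁻¹∈Kernel : ∀ g h → o ▹ g ≡ o ▹ h → Kernel (g ∙ h ⁻¹)
  ▹-≡⇒∙⁻¹∈Kernel g h og≡oh = begin
    o ▹ (g ∙ h ⁻¹)   ≡⟨ ▹-∙ o g (h ⁻¹) ⟩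
    (o ▹ g) ▹ (h ⁻¹) ≡⟨ cong (_▹ (h ⁻¹)) og≡oh ⟩
    (o ▹ h) ▹ (h ⁻¹) ≡⟨ ▹-∙ o h (h ⁻¹) ⟨
    o ▹ (h ∙ h ⁻¹)   ≡⟨ ▹-cong o (inverseʳ h) ⟩
    o ▹ ε            ∎

ℤⁿ : ℕ → Group 0ℓ 0ℓ
ℤⁿ n = AbelianGroup.group (Pointwise.abelianGroup (Fin n) ℤP.+-0-abelianGroup)

module Translation {n} (A : StreamAutomaton n) (path-independent : PathIndependent A) where
  open StreamAutomaton A
  open Group (ℤⁿ n) using (_∙_)
  open ≡-Reasoning

  _▹_ : Config → Vecℤ n → Config
  s ▹ x = _+ᶜ_ A x s

  ⊕*≡▹freq : ∀ s σ → s ⊕* σ ≡ s ▹ freq σ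
  ⊕*≡▹freq s σ = path-independent s σ (streamOf (freq σ)) (sym ∘ freq-streamOf (freq σ))

  ▹-cong : ∀ s {x y} → x ≗ y → s ▹ x ≡ s ▹ y
  ▹-cong s {x} {y} x≗y = path-independent s (streamOf x) (streamOf y) λ j → begin
    freq (streamOf x) j ≡⟨ freq-streamOf x j ⟩
    x j                 ≡⟨ x≗y j ⟩
    y j                 ≡⟨ freq-streamOf y j ⟨
    freq (streamOf y) j ∎

  ▹-∙ : ∀ s x y → s ▹ (x ∙ y) ≡ (s ▹ x) ▹ y
  ▹-∙ s x y = begin
    s ▹ (x ∙ y)                         ≡⟨ ▹-cong s freq-streamOf-++ ⟨
    s ▹ freq (streamOf x ++ streamOf y) ≡⟨ ⊕*≡▹freq s (streamOf x ++ streamOf y) ⟨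
    s ⊕* (streamOf x ++ streamOf y)     ≡⟨ Listₚ.foldl-++ _⊕_ s (streamOf x) (streamOf y) ⟩
    (s ▹ x) ▹ y                         ∎
    where
    freq-streamOf-++ : freq (streamOf x ++ streamOf y) ≗ x ∙ y
    freq-streamOf-++ j = trans (freq-++ (streamOf x) (streamOf y) j)
                                 (cong₂ _+ℤ_ (freq-streamOf x j) (freq-streamOf y j))

  open RightActionKernel (ℤⁿ n) init _▹_ ▹-cong ▹-∙ public

lemma3 : ∀ {n : ℕ} (A : StreamAutomaton n) → PathIndependent A →
    -- x + M ↦ x + o is well defined on ℤ^n / M (cosets x + M = y + M iff x - y ∈ M)
    (∀ (x y : Vecℤ n) → InKernel A (x -ᵥ y) →
      _+ᶜ_ A x (StreamAutomaton.init A) ≡ _+ᶜ_ A y (StreamAutomaton.init A))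
    -- injective
    × (∀ (x y : Vecℤ n) →
      _+ᶜ_ A x (StreamAutomaton.init A) ≡ _+ᶜ_ A y (StreamAutomaton.init A) →
      InKernel A (x -ᵥ y))
    -- onto the reachable configurations (and lands in them)
    × (∀ (c : StreamAutomaton.Config A) → Reachable A c →
      Σ (Vecℤ n) λ x → _+ᶜ_ A x (StreamAutomaton.init A) ≡ c)
    -- same output on streams whose frequency vectors lie in the same coset
    × (∀ (σ τ : Stream n) → InKernel A (freq σ -ᵥ freq τ) →
      StreamAutomaton.run A σ ≡ StreamAutomaton.run A τ)
lemma3 A path-independent =
    ∙⁻¹∈Kernel⇒▹-≡
  , ▹-≡⇒∙⁻¹∈Kernel
  , (λ c (x , c≡x+o) → x , sym c≡x+o)
  , λ σ τ freqσ-freqτ∈M → cong out (begin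
      init ⊕* σ       ≡⟨ ⊕*≡▹freq init σ ⟩
      init ▹ freq σ   ≡⟨ ∙⁻¹∈Kernel⇒▹-≡ (freq σ) (freq τ) freqσ-freqτ∈M ⟩
      init ▹ freq τ   ≡⟨ ⊕*≡▹freq init τ ⟨
      init ⊕* τ       ∎)
  where
  open StreamAutomaton A
  open Translation A path-independent
  open ≡-Reasoning
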